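{- Let $G$ be a connected cograph. Then either $\mu(G)=\mu_{\rm t}(G)$, or $\mu(G)=\mu_{\rm d}(G)=n(G)-1$ and $\mu_{\rm t}(G)=\mu_{\rm o}(G)=n(G)-2$.
   Context: A cograph is a graph with no induced path on four vertices; $n(G)$ is the order of $G$. For a connected graph $G$ and $X\subseteq V(G)$, two vertices are $X$-visible if there is a shortest path between them whose internal vertices are not in $X$. $X$ is: a mutual-visibility set if every two vertices of $X$ are $X$-visible; an outer mutual-visibility set if moreover every $x\in X$ and $y\notin X$ are $X$-visible; a dual mutual-visibility set if every two vertices of $X$ and every two vertices of $V(G)\setminus X$ are $X$-visible; a total mutual-visibility set if every two vertices of $G$ are $X$-visible. $\mu,\mu_{\rm o},\mu_{\rm d},\mu_{\rm t}$ denote the respective maximum cardinalities. -}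

module Defs where

open import Data.Nat using (ℕ; zero; suc; _≤_)
open import Data.Fin using (Fin)
open import Data.Fin.Subset using (Subset; _∈_; _∉_; ∣_∣)
open import Data.List using (List; []; _∷_)
open import Data.List.Relation.Unary.All using (All)
open import Data.Product using (Σ; ∃; _×_)
open import Relation.Binary.PropositionalEquality using (_≡_; _≢_)
open import Relation.Nullary using (¬_)

record Graph (n : ℕ) : Set₁ where
  field
    E      : Fin n → Fin n → Set
    sym    : ∀ {u v} → E u v → E v u
    irrefl : ∀ {u} → ¬ E u u

module _ {n : ℕ} (G : Graph n) where
  open Graph G

  data Walk : Fin n → Fin n → ℕ → Set where
    []  : ∀ {u} → Walk u u 0
    _∷_ : ∀ {u w v k} → E u w → Walk w v k → Walk u v (suc k)

  interior : ∀ {u v k} → Walk u v k → List (Fin n)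
  interior [] = []
  interior (e ∷ []) = []
  interior (_∷_ {w = w} e (e' ∷ p)) = w ∷ interior (e' ∷ p)

  Connected : Set
  Connected = ∀ u v → ∃ λ k → Walk u v k

  -- shortest path: a walk of minimum length (hence a path)
  IsShortest : ∀ {u v k} → Walk u v k → Set
  IsShortest {u} {v} {k} _ = ∀ m → Walk u v m → k ≤ m

  Visible : Subset n → Fin n → Fin n → Set
  Visible X u v = Σ ℕ λ k → Σ (Walk u v k) λ p →
    IsShortest p × All (λ w → w ∉ X) (interior p)

  Cograph : Set
  Cograph = ∀ a b c d → a ≢ b → a ≢ c → a ≢ d → b ≢ c → b ≢ d → c ≢ d →
    ¬ (E a b × E b c × E c d × ¬ E a c × ¬ E b d × ¬ E a d)

  MutualVis : Subset n → Set
  MutualVis X = ∀ u v → u ∈ X → v ∈ X → Visible X u v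

  OuterMutualVis : Subset n → Set
  OuterMutualVis X = MutualVis X × (∀ u v → u ∈ X → v ∉ X → Visible X u v)

  DualMutualVis : Subset n → Set
  DualMutualVis X = MutualVis X × (∀ u v → u ∉ X → v ∉ X → Visible X u v)

  TotalMutualVis : Subset n → Set
  TotalMutualVis X = ∀ u v → Visible X u v

IsMaxCard : ∀ {n} → (Subset n → Set) → ℕ → Set
IsMaxCard P m = (∃ λ X → P X × ∣ X ∣ ≡ m) × (∀ X → P X → ∣ X ∣ ≤ m)

-- A connected cograph has diameter at most 2, so X-visibility of two non-adjacent
-- vertices only asks for a common neighbour outside X. A connected cograph has a
-- dominating edge z₁z₂, hence V ∖ {z₁, z₂} is a total mutual-visibility set and
-- μt ≥ n − 2. Since μt ≤ μo, μd ≤ μ ≤ n, the only way to have μ ≠ μt is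
-- μ = n − 1 = μt + 1; a set of size n − 1 leaves a single vertex outside, which
-- makes every mutual-visibility set of that size dual, and every outer one total.
module Submission where

open import Defs
open import Data.Empty using (⊥; ⊥-elim)
open import Data.Fin using (Fin; zero; suc) renaming (_≟_ to _≟ᶠ_)
open import Data.Fin.Properties using (any?)
open import Data.Fin.Subset
  using (Subset; _∈_; _∉_; _⊆_; _⊂_; ∣_∣; ⁅_⁆; _∪_; ∁; _-_; ⊤; inside; outside)
open import Data.Fin.Subset.Properties
  using ( _∈?_; ∈⊤; x∈⁅x⁆; ∣⁅x⁆∣≡1; x∈p∪q⁺; x∈p⇒x∉∁p; x∈p∧x≢y⇒x∈p-y
        ; x∈p⇒∣p-x∣<∣p∣; p⊆q⇒∣p∣≤∣q∣; p⊂q⇒∣p∣<∣q∣; ∣p∣≤n; ∣⊤∣≡n; ∣p∣≡n⇒p≡⊤; ∣∁p∣≡n∸∣p∣ )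
open import Data.List.Relation.Unary.All using ([]; _∷_)
open import Data.Nat using (ℕ; zero; suc; _+_; _∸_; _≤_; _<_; z≤n; s≤s) renaming (_≟_ to _≟ℕ_)
open import Data.Nat.Properties
  using ( ≤-refl; ≤-trans; ≤-total; ≤-antisym; <-irrefl; ≤-<-trans; ≤∧≢⇒<; ≤-pred; <⇒≱
        ; n≤1+n; +-suc; +-monoʳ-≤; ∸-monoʳ-≤; m∸n≤m; module ≤-Reasoning )
open import Data.Product using (∃; _×_; _,_; proj₁; proj₂)
open import Data.Sum using (_⊎_; inj₁; inj₂)
open import Data.Vec using ([]; _∷_; tabulate)
open import Data.Vec.Properties using (lookup∘tabulate; []=⇒lookup; lookup⇒[]=)
open import Relation.Nullary using (¬_; Dec; yes; no; does)
open import Relation.Nullary.Decidable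
  using (dec-true; decidable-stable; ¬?; ¬¬-excluded-middle; _×-dec_; _⊎-dec_)
open import Relation.Nullary.Negation using (¬¬-map)
open import Relation.Binary.PropositionalEquality
  using (_≡_; _≢_; refl; sym; trans; cong; cong₂; subst)

∣p∪q∣≤∣p∣+∣q∣ : ∀ {n} (p q : Subset n) → ∣ p ∪ q ∣ ≤ ∣ p ∣ + ∣ q ∣
∣p∪q∣≤∣p∣+∣q∣ [] [] = z≤n
∣p∪q∣≤∣p∣+∣q∣ (inside ∷ p) (inside ∷ q) =
  s≤s (≤-trans (∣p∪q∣≤∣p∣+∣q∣ p q) (+-monoʳ-≤ ∣ p ∣ (n≤1+n ∣ q ∣)))
∣p∪q∣≤∣p∣+∣q∣ (inside ∷ p) (outside ∷ q) = s≤s (∣p∪q∣≤∣p∣+∣q∣ p q)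
∣p∪q∣≤∣p∣+∣q∣ (outside ∷ p) (inside ∷ q) =
  subst (suc ∣ p ∪ q ∣ ≤_) (sym (+-suc ∣ p ∣ ∣ q ∣)) (s≤s (∣p∪q∣≤∣p∣+∣q∣ p q))
∣p∪q∣≤∣p∣+∣q∣ (outside ∷ p) (outside ∷ q) = ∣p∪q∣≤∣p∣+∣q∣ p q

n∸2≤∣∁⁅x⁆∪⁅y⁆∣ : ∀ {n} (x y : Fin n) → n ∸ 2 ≤ ∣ ∁ (⁅ x ⁆ ∪ ⁅ y ⁆) ∣
n∸2≤∣∁⁅x⁆∪⁅y⁆∣ {n} x y = begin
  n ∸ 2                         ≡⟨ cong₂ (λ a b → n ∸ (a + b)) (sym (∣⁅x⁆∣≡1 x)) (sym (∣⁅x⁆∣≡1 y)) ⟩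
  n ∸ (∣ ⁅ x ⁆ ∣ + ∣ ⁅ y ⁆ ∣)   ≤⟨ ∸-monoʳ-≤ n (∣p∪q∣≤∣p∣+∣q∣ ⁅ x ⁆ ⁅ y ⁆) ⟩
  n ∸ ∣ ⁅ x ⁆ ∪ ⁅ y ⁆ ∣         ≡⟨ sym (∣∁p∣≡n∸∣p∣ (⁅ x ⁆ ∪ ⁅ y ⁆)) ⟩
  ∣ ∁ (⁅ x ⁆ ∪ ⁅ y ⁆) ∣         ∎
  where open ≤-Reasoning

x∈⁅x⁆∪⁅y⁆ : ∀ {n} (x y : Fin n) → x ∈ ⁅ x ⁆ ∪ ⁅ y ⁆
x∈⁅x⁆∪⁅y⁆ x y = x∈p∪q⁺ (inj₁ (x∈⁅x⁆ x))

y∈⁅x⁆∪⁅y⁆ : ∀ {n} (x y : Fin n) → y ∈ ⁅ x ⁆ ∪ ⁅ y ⁆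
y∈⁅x⁆∪⁅y⁆ x y = x∈p∪q⁺ {p = ⁅ x ⁆} (inj₂ (x∈⁅x⁆ y))

∣p∣≡n⇒x∈p : ∀ {n} {p : Subset n} {x} → ∣ p ∣ ≡ n → x ∈ p
∣p∣≡n⇒x∈p ∣p∣≡n = subst (_ ∈_) (sym (∣p∣≡n⇒p≡⊤ ∣p∣≡n)) ∈⊤

2+∣p∣≤n : ∀ {n} {p : Subset n} {x y} → x ≢ y → x ∉ p → y ∉ p → 2 + ∣ p ∣ ≤ n
2+∣p∣≤n {n} {p} {x} {y} x≢y x∉p y∉p = begin-strict
  suc ∣ p ∣          ≤⟨ s≤s (p⊆q⇒∣p∣≤∣q∣ p⊆⊤-x-y) ⟩
  suc ∣ ⊤ - x - y ∣  ≤⟨ x∈p⇒∣p-x∣<∣p∣ {x = y} {p = ⊤ - x} (x∈p∧x≢y⇒x∈p-y ∈⊤ (λ y≡x → x≢y (sym y≡x))) ⟩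
  ∣ ⊤ - x ∣          <⟨ x∈p⇒∣p-x∣<∣p∣ {x = x} {p = ⊤} ∈⊤ ⟩
  ∣ ⊤ {n} ∣          ≡⟨ ∣⊤∣≡n n ⟩
  n                  ∎
  where
  open ≤-Reasoning
  p⊆⊤-x-y : p ⊆ ⊤ - x - y
  p⊆⊤-x-y z∈p = x∈p∧x≢y⇒x∈p-y (x∈p∧x≢y⇒x∈p-y ∈⊤ λ { refl → x∉p z∈p }) λ { refl → y∉p z∈p }

∉-unique : ∀ {n} {p : Subset n} → suc ∣ p ∣ ≡ n → ∀ x y → x ∉ p → y ∉ p → x ≡ y
∉-unique 1+∣p∣≡n x y x∉p y∉p with x ≟ᶠ y
... | yes x≡y = x≡y
... | no x≢y  = ⊥-elim (<-irrefl 1+∣p∣≡n (2+∣p∣≤n x≢y x∉p y∉p))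

module _ {n} {P : Fin n → Set} (P? : ∀ x → Dec (P x)) where

  subsetOf : Subset n
  subsetOf = tabulate λ x → does (P? x)

  ∈subsetOf⁺ : ∀ {x} → P x → x ∈ subsetOf
  ∈subsetOf⁺ {x} px = lookup⇒[]= x _ (trans (lookup∘tabulate _ x) (dec-true (P? x) px))

  ∈subsetOf⁻ : ∀ {x} → x ∈ subsetOf → P x
  ∈subsetOf⁻ {x} x∈ with P? x | trans (sym (lookup∘tabulate _ x)) ([]=⇒lookup x∈)
  ... | yes px | _ = px

maximise : ∀ {n} {P : Fin n → Set} → (∀ i → Dec (P i)) → (f : Fin n → ℕ) →
  (∀ i → ¬ P i) ⊎ ∃ λ i → P i × ∀ j → P j → f j ≤ f i
maximise {zero} P? f = inj₁ λ ()
maximise {suc n} P? f with maximise (λ i → P? (suc i)) (λ i → f (suc i)) | P? zero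
... | inj₁ none | no ¬p₀ = inj₁ λ { zero → ¬p₀ ; (suc j) → none j }
... | inj₁ none | yes p₀ = inj₂ (zero , p₀ , λ { zero _ → ≤-refl ; (suc j) pj → ⊥-elim (none j pj) })
... | inj₂ (i , pi , max) | no ¬p₀ = inj₂ (suc i , pi , λ { zero p₀ → ⊥-elim (¬p₀ p₀) ; (suc j) → max j })
... | inj₂ (i , pi , max) | yes p₀ with ≤-total (f zero) (f (suc i))
...   | inj₁ f₀≤fi = inj₂ (suc i , pi , λ { zero _ → f₀≤fi ; (suc j) → max j })
...   | inj₂ fi≤f₀ = inj₂ (zero , p₀ , λ { zero _ → ≤-refl ; (suc j) pj → ≤-trans (max j pj) fi≤f₀ })

¬¬-∀-Fin : ∀ {n} {P : Fin n → Set} → (∀ i → ¬ ¬ P i) → ¬ ¬ (∀ i → P i)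
¬¬-∀-Fin {zero} _ ¬∀ = ¬∀ λ ()
¬¬-∀-Fin {suc n} ¬¬P ¬∀ = ¬¬P zero λ p₀ →
  ¬¬-∀-Fin (λ i → ¬¬P (suc i)) λ ps → ¬∀ λ { zero → p₀ ; (suc i) → ps i }

IsMaxCard-mono : ∀ {n} {P Q : Subset n → Set} {a b} →
  (∀ X → P X → Q X) → IsMaxCard P a → IsMaxCard Q b → a ≤ b
IsMaxCard-mono P⇒Q ((X , PX , refl) , _) (_ , maxQ) = maxQ X (P⇒Q X PX)

squeeze : ∀ {n a b} → n ∸ 2 ≤ a → a < b → b < n → suc a ≡ b × suc b ≡ n
squeeze {suc zero} _ () (s≤s z≤n)
squeeze {suc (suc k)} k≤a a<b (s≤s b≤1+k) =
  ≤-antisym a<b (≤-trans b≤1+k (s≤s k≤a)) ,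
  cong suc (≤-antisym b≤1+k (≤-trans (s≤s k≤a) a<b))

module _ {n} {G : Graph n} where
  open Graph G renaming (sym to E-sym)

  visible-refl : ∀ X u → Visible G X u u
  visible-refl X u = 0 , [] , (λ _ _ → z≤n) , []

  visible-edge : ∀ X {u v} → E u v → Visible G X u v
  visible-edge X {u} {v} uv = 1 , uv ∷ [] , shortest , []
    where
    shortest : ∀ m → Walk G u v m → 1 ≤ m
    shortest zero [] = ⊥-elim (irrefl uv)
    shortest (suc m) _ = s≤s z≤n

  visible-via : ∀ X {u v w} → u ≢ v → ¬ E u v → E u w → E w v → w ∉ X → Visible G X u v
  visible-via X {u} {v} u≢v ¬uv uw wv w∉X = 2 , uw ∷ wv ∷ [] , shortest , w∉X ∷ []
    where
    shortest : ∀ m → Walk G u v m → 2 ≤ m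
    shortest zero [] = ⊥-elim (u≢v refl)
    shortest (suc zero) (uv ∷ []) = ⊥-elim (¬uv uv)
    shortest (suc (suc m)) _ = s≤s (s≤s z≤n)

  total⇒mutual : ∀ {X} → TotalMutualVis G X → MutualVis G X
  total⇒mutual tv u v _ _ = tv u v

  total⇒outer : ∀ {X} → TotalMutualVis G X → OuterMutualVis G X
  total⇒outer tv = total⇒mutual tv , λ u v _ _ → tv u v

  covering-mutual⇒total : ∀ {X} → (∀ u → u ∈ X) → MutualVis G X → TotalMutualVis G X
  covering-mutual⇒total ∈X mv u v = mv u v (∈X u) (∈X v)

  cosingleton-mutual⇒dual : ∀ {X} → (∀ u v → u ∉ X → v ∉ X → u ≡ v) →
    MutualVis G X → DualMutualVis G X
  cosingleton-mutual⇒dual unique mv = mv , λ u v u∉X v∉X →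
    subst (Visible G _ u) (unique u v u∉X v∉X) (visible-refl _ u)

  isolated-connected⇒trivial : Connected G → ∀ {z} → (∀ y → ¬ E z y) → ∀ v → z ≡ v
  isolated-connected⇒trivial conn {z} isolated v with conn z v
  ... | _ , []         = refl
  ... | _ , (zy ∷ _) = ⊥-elim (isolated _ zy)

  cograph-no-induced-P₄ : Cograph G → ∀ {a b c d} →
    E a b → E b c → E c d → ¬ E a c → ¬ E b d → ¬ E a d → ⊥
  cograph-no-induced-P₄ cog ab bc cd ¬ac ¬bd ¬ad =
    cog _ _ _ _ (λ { refl → irrefl ab }) (λ { refl → ¬ad cd }) (λ { refl → ¬ac (E-sym cd) })
                (λ { refl → irrefl bc }) (λ { refl → ¬ad ab }) (λ { refl → irrefl cd })
                (ab , bc , cd , ¬ac , ¬bd , ¬ad)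

module DecidableCograph {n} {G : Graph n} (E? : ∀ u v → Dec (Graph.E G u v)) (cog : Cograph G) where
  open Graph G renaming (sym to E-sym)

  common-neighbour-on-3-walk : ∀ {u a b v} → E u a → E a b → E b v → ¬ E u v →
    (E u a × E a v) ⊎ (E u b × E b v)
  common-neighbour-on-3-walk {u} {a} {b} {v} ua ab bv ¬uv with E? u b | E? a v
  ... | yes ub | _      = inj₂ (ub , bv)
  ... | no _   | yes av = inj₁ (ua , av)
  ... | no ¬ub | no ¬av = ⊥-elim (cograph-no-induced-P₄ {G = G} cog ua ab bv ¬ub ¬av ¬uv)

  Dist≤2 : Fin n → Fin n → Set
  Dist≤2 u v = u ≡ v ⊎ E u v ⊎ ∃ λ w → E u w × E w v

  dist≤2-step : ∀ {u w v} → E u w → Dist≤2 w v → Dist≤2 u v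
  dist≤2-step uw (inj₁ refl) = inj₂ (inj₁ uw)
  dist≤2-step uw (inj₂ (inj₁ wv)) = inj₂ (inj₂ (_ , uw , wv))
  dist≤2-step {u} {w} {v} uw (inj₂ (inj₂ (c , wc , cv))) with E? u v
  ... | yes uv = inj₂ (inj₁ uv)
  ... | no ¬uv with common-neighbour-on-3-walk uw wc cv ¬uv
  ...   | inj₁ common = inj₂ (inj₂ (w , common))
  ...   | inj₂ common = inj₂ (inj₂ (c , common))

  walk⇒dist≤2 : ∀ {u v k} → Walk G u v k → Dist≤2 u v
  walk⇒dist≤2 [] = inj₁ refl
  walk⇒dist≤2 (e ∷ p) = dist≤2-step e (walk⇒dist≤2 p)

  dist≤2⇒short-walk : ∀ {u v} → Dist≤2 u v → ∃ λ k → k ≤ 2 × Walk G u v k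
  dist≤2⇒short-walk (inj₁ refl) = 0 , z≤n , []
  dist≤2⇒short-walk (inj₂ (inj₁ uv)) = 1 , s≤s z≤n , uv ∷ []
  dist≤2⇒short-walk (inj₂ (inj₂ (_ , uw , wv))) = 2 , ≤-refl , uw ∷ wv ∷ []

  visible⇒common-neighbour : ∀ {X u v} → Visible G X u v →
    u ≡ v ⊎ E u v ⊎ ∃ λ w → E u w × E w v × w ∉ X
  visible⇒common-neighbour (0 , [] , _) = inj₁ refl
  visible⇒common-neighbour (1 , uv ∷ [] , _) = inj₂ (inj₁ uv)
  visible⇒common-neighbour (2 , uw ∷ wv ∷ [] , _ , w∉X ∷ []) = inj₂ (inj₂ (_ , uw , wv , w∉X))
  visible⇒common-neighbour (suc (suc (suc _)) , p , shortest , _)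
    with dist≤2⇒short-walk (walk⇒dist≤2 p)
  ... | k , k≤2 , q with ≤-trans (shortest k q) k≤2
  ...   | s≤s (s≤s ())

  cosingleton-outer⇒total : ∀ {X} → (∀ u v → u ∉ X → v ∉ X → u ≡ v) →
    OuterMutualVis G X → TotalMutualVis G X
  cosingleton-outer⇒total {X} unique (mv , ov) u v with u ∈? X | v ∈? X
  ... | yes u∈X | yes v∈X = mv u v u∈X v∈X
  ... | yes u∈X | no v∉X  = ov u v u∈X v∉X
  ... | no u∉X  | no v∉X  = subst (Visible G X u) (unique u v u∉X v∉X) (visible-refl X u)
  ... | no u∉X  | yes v∈X with visible⇒common-neighbour (ov v u v∈X u∉X)
  ...   | inj₁ refl = visible-refl X u
  ...   | inj₂ (inj₁ vu) = visible-edge X (E-sym vu)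
  ...   | inj₂ (inj₂ (w , _ , wu , w∉X)) with unique w u w∉X u∉X
  ...     | refl = ⊥-elim (irrefl wu)

  -- Maximising ∣ private-neighbours z y ∣ over the neighbours y of z yields a
  -- dominating edge zy.
  private-neighbour? : ∀ z y x → Dec (¬ E x z × E x y)
  private-neighbour? z y x = ¬? (E? x z) ×-dec E? x y

  private-neighbours : Fin n → Fin n → Subset n
  private-neighbours z y = subsetOf (private-neighbour? z y)

  module _ {z z₂ y x : Fin n} (zz₂ : E z z₂) (zy : E z y)
           (xy : E x y) (¬xz : ¬ E x z) (¬xz₂ : ¬ E x z₂) where

    private-neighbours-⊂ : private-neighbours z z₂ ⊂ private-neighbours z y
    private-neighbours-⊂ = ⊆ , x , ∈subsetOf⁺ (private-neighbour? z y) (¬xz , xy) ,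
                             λ x∈ → ¬xz₂ (proj₂ (∈subsetOf⁻ (private-neighbour? z z₂) x∈))
      where
      ⊆ : private-neighbours z z₂ ⊆ private-neighbours z y
      ⊆ {x′} x′∈ with ∈subsetOf⁻ (private-neighbour? z z₂) x′∈ | E? x′ y
      ... | ¬x′z , _ | yes x′y = ∈subsetOf⁺ (private-neighbour? z y) (¬x′z , x′y)
      ... | ¬x′z , x′z₂ | no ¬x′y = ⊥-elim (impossible x′z₂ ¬x′z ¬x′y)
        where
        impossible : ∀ {x′} → E x′ z₂ → ¬ E x′ z → ¬ E x′ y → ⊥
        impossible {x′} x′z₂ ¬x′z ¬x′y
          with common-neighbour-on-3-walk x′z₂ (E-sym zz₂) zy ¬x′y
        ... | inj₂ (x′z , _) = ¬x′z x′z
        ... | inj₁ (_ , z₂y) with E? x′ x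
        ...   | no ¬x′x with common-neighbour-on-3-walk x′z₂ z₂y (E-sym xy) ¬x′x
        ...     | inj₁ (_ , z₂x) = ¬xz₂ (E-sym z₂x)
        ...     | inj₂ (x′y , _) = ¬x′y x′y
        impossible x′z₂ ¬x′z ¬x′y | inj₁ _ | yes x′x
          with common-neighbour-on-3-walk (E-sym x′x) x′z₂ (E-sym zz₂) ¬xz
        ...     | inj₁ (_ , x′z) = ¬x′z x′z
        ...     | inj₂ (xz₂ , _) = ¬xz₂ xz₂

  dominating-edge : Connected G → ∀ {z z₂} → E z z₂ →
    (∀ y → E z y → ∣ private-neighbours z y ∣ ≤ ∣ private-neighbours z z₂ ∣) →
    ∀ x → E x z ⊎ E x z₂
  dominating-edge conn {z} {z₂} zz₂ max x with E? x z | E? x z₂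
  ... | yes xz | _ = inj₁ xz
  ... | no _ | yes xz₂ = inj₂ xz₂
  ... | no ¬xz | no ¬xz₂ with walk⇒dist≤2 (proj₂ (conn z x))
  ...   | inj₁ refl = inj₂ zz₂
  ...   | inj₂ (inj₁ zx) = ⊥-elim (¬xz (E-sym zx))
  ...   | inj₂ (inj₂ (y , zy , yx)) =
    ⊥-elim (<-irrefl refl (≤-<-trans (max y zy)
      (p⊂q⇒∣p∣<∣q∣ (private-neighbours-⊂ zz₂ zy (E-sym yx) ¬xz ¬xz₂))))

  dominating-edge-exists : Connected G → ∀ {z y} → E z y → ∃ λ z₂ → E z z₂ × ∀ x → E x z ⊎ E x z₂
  dominating-edge-exists conn {z} {y} zy with maximise (E? z) (λ y → ∣ private-neighbours z y ∣)
  ... | inj₁ isolated = ⊥-elim (isolated y zy)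
  ... | inj₂ (z₂ , zz₂ , max) = z₂ , zz₂ , dominating-edge conn zz₂ max

  dominating-edge⇒common-neighbour : ∀ {a b} → E a b → (∀ x → E x a ⊎ E x b) →
    ∀ {u v} → ¬ E u v → ∃ λ w → w ∈ ⁅ a ⁆ ∪ ⁅ b ⁆ × E u w × E w v
  dominating-edge⇒common-neighbour {a} {b} ab dom ¬uv with dom _ | dom _
  ... | inj₁ ua | inj₁ va = a , x∈⁅x⁆∪⁅y⁆ a b , ua , E-sym va
  ... | inj₂ ub | inj₂ vb = b , y∈⁅x⁆∪⁅y⁆ a b , ub , E-sym vb
  ... | inj₁ ua | inj₂ vb with common-neighbour-on-3-walk ua ab (E-sym vb) ¬uv
  ...   | inj₁ common = a , x∈⁅x⁆∪⁅y⁆ a b , common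
  ...   | inj₂ common = b , y∈⁅x⁆∪⁅y⁆ a b , common
  dominating-edge⇒common-neighbour {a} {b} ab dom ¬uv | inj₂ ub | inj₁ va
    with common-neighbour-on-3-walk ub (E-sym ab) (E-sym va) ¬uv
  ...   | inj₁ common = b , y∈⁅x⁆∪⁅y⁆ a b , common
  ...   | inj₂ common = a , x∈⁅x⁆∪⁅y⁆ a b , common

  dominating-edge⇒total : ∀ {a b} → E a b → (∀ x → E x a ⊎ E x b) →
    TotalMutualVis G (∁ (⁅ a ⁆ ∪ ⁅ b ⁆))
  dominating-edge⇒total ab dom u v with u ≟ᶠ v | E? u v
  ... | yes refl | _      = visible-refl _ u
  ... | no _     | yes uv = visible-edge _ uv
  ... | no u≢v   | no ¬uv with dominating-edge⇒common-neighbour ab dom ¬uv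
  ...   | w , w∈ , uw , wv = visible-via _ u≢v ¬uv uw wv (x∈p⇒x∉∁p w∈)

  large-total-set : Connected G → ∃ λ T → TotalMutualVis G T × n ∸ 2 ≤ ∣ T ∣
  large-total-set conn with any? (λ z → any? (E? z))
  ... | yes (z , _ , zy) with dominating-edge-exists conn zy
  ...   | z₂ , zz₂ , dom = _ , dominating-edge⇒total zz₂ dom , n∸2≤∣∁⁅x⁆∪⁅y⁆∣ z z₂
  large-total-set conn | no edgeless = ⊤ , total , subst (n ∸ 2 ≤_) (sym (∣⊤∣≡n n)) (m∸n≤m n 2)
    where
    total : TotalMutualVis G ⊤
    total u v with isolated-connected⇒trivial conn (λ y uy → edgeless (u , y , uy)) v
    ... | refl = visible-refl ⊤ u

  μt<μ⇒extremal : Connected G → ∀ {μ μt μd μo} →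
    IsMaxCard (MutualVis G) μ → IsMaxCard (TotalMutualVis G) μt →
    IsMaxCard (DualMutualVis G) μd → IsMaxCard (OuterMutualVis G) μo →
    μt < μ → μ ≡ n ∸ 1 × μd ≡ n ∸ 1 × μt ≡ n ∸ 2 × μo ≡ n ∸ 2
  μt<μ⇒extremal conn {μ} {μt} {μd} {μo} hM@((Xm , mvXm , ∣Xm∣≡μ) , _) hT@(_ , maxT) hD@(_ , maxD)
                hO@((Xo , ovXo , ∣Xo∣≡μo) , _) μt<μ =
    μ≡n∸1 , trans μd≡μ μ≡n∸1 , μt≡n∸2 , trans μo≡μt μt≡n∸2
    where
    no-total-of-size-μ : ∀ {X} → TotalMutualVis G X → ∣ X ∣ ≢ μ
    no-total-of-size-μ {X} tX ∣X∣≡μ = <⇒≱ μt<μ (subst (_≤ μt) ∣X∣≡μ (maxT X tX))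

    μ<n : μ < n
    μ<n = ≤∧≢⇒< (subst (_≤ n) ∣Xm∣≡μ (∣p∣≤n Xm)) λ μ≡n →
      no-total-of-size-μ (covering-mutual⇒total (λ _ → ∣p∣≡n⇒x∈p (trans ∣Xm∣≡μ μ≡n)) mvXm) ∣Xm∣≡μ

    n∸2≤μt : n ∸ 2 ≤ μt
    n∸2≤μt with large-total-set conn
    ... | T , tT , n∸2≤∣T∣ = ≤-trans n∸2≤∣T∣ (maxT T tT)

    1+μt≡μ : suc μt ≡ μ
    1+μt≡μ = proj₁ (squeeze n∸2≤μt μt<μ μ<n)

    1+μ≡n : suc μ ≡ n
    1+μ≡n = proj₂ (squeeze n∸2≤μt μt<μ μ<n)

    unique : ∀ {X} → ∣ X ∣ ≡ μ → ∀ u v → u ∉ X → v ∉ X → u ≡ v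
    unique ∣X∣≡μ = ∉-unique (trans (cong suc ∣X∣≡μ) 1+μ≡n)

    μd≡μ : μd ≡ μ
    μd≡μ = ≤-antisym (IsMaxCard-mono (λ _ → proj₁) hD hM)
      (subst (_≤ μd) ∣Xm∣≡μ (maxD Xm (cosingleton-mutual⇒dual (unique ∣Xm∣≡μ) mvXm)))

    μo<μ : μo < μ
    μo<μ = ≤∧≢⇒< (IsMaxCard-mono (λ _ → proj₁) hO hM) λ μo≡μ →
      let ∣Xo∣≡μ = trans ∣Xo∣≡μo μo≡μ in
      no-total-of-size-μ (cosingleton-outer⇒total (unique ∣Xo∣≡μ) ovXo) ∣Xo∣≡μ

    μo≡μt : μo ≡ μt
    μo≡μt = ≤-antisym (≤-pred (subst (μo <_) (sym 1+μt≡μ) μo<μ))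
                      (IsMaxCard-mono (λ _ → total⇒outer) hT hO)

    μ≡n∸1 : μ ≡ n ∸ 1
    μ≡n∸1 = cong (_∸ 1) 1+μ≡n

    μt≡n∸2 : μt ≡ n ∸ 2
    μt≡n∸2 = cong (_∸ 2) (trans (cong suc 1+μt≡μ) 1+μ≡n)

  visibility-dichotomy : Connected G → ∀ {μ μt μd μo} →
    IsMaxCard (MutualVis G) μ → IsMaxCard (TotalMutualVis G) μt →
    IsMaxCard (DualMutualVis G) μd → IsMaxCard (OuterMutualVis G) μo →
    μ ≡ μt ⊎ (μ ≡ n ∸ 1 × μd ≡ n ∸ 1 × μt ≡ n ∸ 2 × μo ≡ n ∸ 2)
  visibility-dichotomy conn {μ} {μt} hM hT hD hO with μ ≟ℕ μt
  ... | yes μ≡μt = inj₁ μ≡μt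
  ... | no μ≢μt  = inj₂ (μt<μ⇒extremal conn hM hT hD hO μt<μ)
    where
    μt<μ : μt < μ
    μt<μ = ≤∧≢⇒< (IsMaxCard-mono (λ _ → total⇒mutual) hT hM) (λ μt≡μ → μ≢μt (sym μt≡μ))

theorem4p7 : (n : ℕ) (G : Graph n) → Connected G → Cograph G →
    (μ μt μd μo : ℕ) →
    IsMaxCard (MutualVis G) μ → IsMaxCard (TotalMutualVis G) μt →
    IsMaxCard (DualMutualVis G) μd → IsMaxCard (OuterMutualVis G) μo →
    μ ≡ μt ⊎ (μ ≡ n ∸ 1 × μd ≡ n ∸ 1 × μt ≡ n ∸ 2 × μo ≡ n ∸ 2)
theorem4p7 n G conn cog μ μt μd μo hM hT hD hO =
  decidable-stable conclusion?
    (¬¬-map (λ E? → DecidableCograph.visibility-dichotomy E? cog conn hM hT hD hO) adjacency-decidable)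
  where
  conclusion? = (μ ≟ℕ μt) ⊎-dec ((μ ≟ℕ n ∸ 1) ×-dec ((μd ≟ℕ n ∸ 1) ×-dec
                ((μt ≟ℕ n ∸ 2) ×-dec (μo ≟ℕ n ∸ 2))))
  -- Adjacency need not be decidable, but it is so up to double negation, which
  -- suffices because the conclusion is decidable.
  adjacency-decidable : ¬ ¬ (∀ u v → Dec (Graph.E G u v))
  adjacency-decidable = ¬¬-∀-Fin λ u → ¬¬-∀-Fin λ v → ¬¬-excluded-middle
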